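{- A linear hypergraph is uniform and regular and admits a group of automorphisms acting regularly on its vertex set if and only if its incidence graph is (isomorphic to) a Cayley incidence graph $\mathrm{BCay}(G,\pi)$ for some group $G$ and some collection $\pi$ as below.
   Context: A hypergraph is uniform if all hyperedges have the same size, regular if every vertex lies in the same number of hyperedges, and linear if any two distinct hyperedges share at most one vertex. Its incidence graph is the bipartite graph on vertices and hyperedges, with a vertex adjacent to a hyperedge iff it belongs to it. For a group $G$ with identity $e$, $C\subseteq G$, $g\in G$, $gC=\{gs:s\in C\}$. A collection $\pi$ of subsets of $G$, each containing $e$, satisfies the $T$-axiom if for every $C\in\pi$ and $s\in C$, $s^{ -1}C\in\pi$. Given a collection $\pi=\{C_1,\dots,C_\ell\}$ of distinct subsets of $G$ each of size $k$ containing $e$, pairwise intersecting exactly in $\{e\}$ and satisfying the $T$-axiom, the Cayley incidence graph $\mathrm{BCay}(G,\pi)$ is the bipartite graph with parts $\gamma=G$ and $\beta=\{gC:g\in G,C\in\pi\}$ (a set of subsets of $G$), with an edge between $g$ and $gC$ for every $g\in G$, $C\in\pi$; equivalently $g$ is adjacent to $D\in\beta$ iff $g\in D$. -}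

module Defs where

open import Data.Nat using (ℕ; _≤_; NonZero)
open import Data.Fin using (Fin)
open import Data.Fin.Subset using (Subset; _∈_; _∩_; ⁅_⁆; ∣_∣; Nonempty)
open import Data.Fin.Subset.Properties using (_∈?_)
open import Data.Fin.Permutation using (Permutation′; _⟨$⟩ʳ_; _∘ₚ_; id; flip)
open import Data.Vec using (tabulate; lookup)
open import Data.Product using (Σ; ∃; ∃-syntax; _×_)
open import Relation.Nullary using (¬_; does)
open import Relation.Binary.PropositionalEquality using (_≡_; _≢_)
open import Function using (_⇔_; Injective; _↔_; Inverse)

-- Finite hypergraphs
-- Vertex set Fin n (nonempty), hyperedges indexed by Fin m, each hyperedge
-- a nonempty subset of the vertices; hyperedges are distinct (a hypergraph
-- has a *set* of hyperedges), i.e. the indexing is injective.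

record Hypergraph : Set where
  field
    n        : ℕ
    m        : ℕ
    .{{n≢0}} : NonZero n
    edge     : Fin m → Subset n
    edge-inj : Injective _≡_ _≡_ edge
    edge-ne  : ∀ e → Nonempty (edge e)

module _ (H : Hypergraph) where
  open Hypergraph H

  degree : Fin n → ℕ
  degree v = ∣ tabulate (λ e → does (v ∈? edge e)) ∣

  Uniform : Set
  Uniform = ∃[ k ] (∀ e → ∣ edge e ∣ ≡ k)

  Regular : Set
  Regular = ∃[ r ] (∀ v → degree v ≡ r)

  Linear : Set
  Linear = ∀ e e′ → e ≢ e′ → ∣ edge e ∩ edge e′ ∣ ≤ 1

  IsAutomorphism : Permutation′ n → Set
  IsAutomorphism σ = ∀ e → ∃[ e′ ] (∀ v → (v ∈ edge e) ⇔ ((σ ⟨$⟩ʳ v) ∈ edge e′))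

  -- A group of automorphisms (a subgroup A of Aut(H), given as a predicate on
  -- permutations, closed under identity, composition and inverses) acting
  -- regularly on the vertex set: for all u, v there is exactly one a ∈ A
  -- with a(u) = v (uniqueness up to equality of permutations as functions).
  record RegularAutGroup : Set₁ where
    field
      A       : Permutation′ n → Set
      A-aut   : ∀ σ → A σ → IsAutomorphism σ
      A-id    : A id
      A-comp  : ∀ σ τ → A σ → A τ → A (σ ∘ₚ τ)
      A-inv   : ∀ σ → A σ → A (flip σ)
      transitive : ∀ u v → ∃[ σ ] (A σ × σ ⟨$⟩ʳ u ≡ v)
      free    : ∀ σ τ u → A σ → A τ → σ ⟨$⟩ʳ u ≡ τ ⟨$⟩ʳ u →
                ∀ w → σ ⟨$⟩ʳ w ≡ τ ⟨$⟩ʳ w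

  AdmitsRegularAutGroup : Set₁
  AdmitsRegularAutGroup = RegularAutGroup

record FinGroup : Set where
  infixl 7 _·_
  field
    N      : ℕ
    _·_    : Fin N → Fin N → Fin N
    e      : Fin N
    inv    : Fin N → Fin N
    assoc  : ∀ x y z → (x · y) · z ≡ x · (y · z)
    idˡ    : ∀ x → e · x ≡ x
    idʳ    : ∀ x → x · e ≡ x
    invˡ   : ∀ x → inv x · x ≡ e
    invʳ   : ∀ x → x · inv x ≡ e

module _ (G : FinGroup) where
  open FinGroup G

  -- gC = { g s : s ∈ C };  x ∈ gC iff g⁻¹ x ∈ C
  translate : Fin N → Subset N → Subset N
  translate g C = tabulate (λ x → lookup C (inv g · x))

  record CayleyCollection : Set where
    field
      ℓ       : ℕ
      k       : ℕ
      C       : Fin ℓ → Subset N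
      distinct : Injective _≡_ _≡_ C
      size    : ∀ i → ∣ C i ∣ ≡ k
      has-e   : ∀ i → e ∈ C i
      meet    : ∀ i j → i ≢ j → C i ∩ C j ≡ ⁅ e ⁆
      T-axiom : ∀ i s → s ∈ C i → ∃[ j ] (translate (inv s) (C i) ≡ C j)

  InBeta : CayleyCollection → Subset N → Set
  InBeta π D = ∃[ g ] ∃[ i ] (D ≡ translate g (CayleyCollection.C π i))

  -- Isomorphism between the incidence graph of H and BCay(G, π), as bipartite
  -- graphs (vertices of H ↦ γ = G, hyperedges of H ↦ β):
  -- a bijection φ : V → G, a bijection ψ : E → β, preserving incidence
  -- (v ∈ e  iff  φ v ∈ ψ e, the adjacency of BCay(G,π)).
  record BCayIso (H : Hypergraph) (π : CayleyCollection) : Set where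
    open Hypergraph H using (n; m; edge)
    field
      φ     : Fin n ↔ Fin N
      ψ     : Fin m → Subset N
      ψ-inj : Injective _≡_ _≡_ ψ
      ψ-into : ∀ e → InBeta π (ψ e)
      ψ-onto : ∀ D → InBeta π D → ∃[ e ] (ψ e ≡ D)
      incidence : ∀ v e → (v ∈ edge e) ⇔ ((Inverse.to φ v) ∈ ψ e)

IsBCayIncidence : Hypergraph → Set
IsBCayIncidence H = ∃[ G ] Σ (CayleyCollection G) (λ π → BCayIso G H π)

-- Fix a base vertex o. If a group A of automorphisms acts regularly on the vertices, each
-- vertex x is named by the unique element of A sending o to x, and composing these makes the
-- vertex set a group acting on itself by left multiplication. The hyperedges through o form π:
-- linearity makes them pairwise meet exactly in o, and since left multiplications are
-- automorphisms every hyperedge is a translate gC of one of them, while a translate of a hyperedge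
-- through o that still contains o is again one of them, which is the T-axiom. Conversely, in
-- BCay(G, π) left multiplication by y sends gC to (yg)C, so G acts regularly on the vertices by
-- maps that permute the hyperedges; this is the automorphism group, it forces all degrees to be
-- equal, and all hyperedges have size k because translation preserves cardinality.
module Submission where

open import Defs
open import Algebra.Bundles using (Group)
import Algebra.Properties.CommutativeMonoid.Sum as Sum
import Algebra.Properties.Group as GroupProperties
open import Data.Bool using (Bool; true; false; if_then_else_)
open import Data.Bool.Properties using (⇔→≡)
open import Data.Fin using (Fin; zero; suc; _≟_; fromℕ<)
open import Data.Fin.Permutation
  using (Permutation; Permutation′; permutation; _⟨$⟩ʳ_; _⟨$⟩ˡ_; _∘ₚ_; id; flip; inverseˡ; inverseʳ)
  renaming (_≈_ to _≈ₚ_)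
open import Data.Fin.Subset using (Subset; _∈_; ⁅_⁆; ∣_∣; _⊂_)
open import Data.Fin.Subset.Properties
  using (_∈?_; ⊆-antisym; x∈⁅x⁆; x∈⁅y⁆⇒x≡y; ∣⁅x⁆∣≡1; p⊂q⇒∣p∣<∣q∣; x∈p∩q⁺)
open import Data.List using (List; _∷_; length; filter; allFin)
import Data.List as List
open import Data.List.Membership.Propositional using () renaming (_∈_ to _∈ₗ_)
open import Data.List.Membership.Propositional.Properties using (∈-filter⁺; ∈-filter⁻; ∈-lookup; ∈-allFin)
open import Data.List.Relation.Unary.Any using (index)
open import Data.List.Relation.Unary.Any.Properties using (lookup-index)
open import Data.List.Relation.Unary.Unique.Propositional using (Unique; _∷_)
open import Data.List.Relation.Unary.Unique.Propositional.Properties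
  using (filter⁺; allFin⁺; Unique[x∷xs]⇒x∉xs)
open import Data.Nat using (ℕ; suc; _≤_; _<_; >-nonZero⁻¹)
open import Data.Nat.Properties using (+-0-commutativeMonoid; ≤⇒≯)
open import Data.Product using (∃-syntax; _×_; _,_; proj₁; proj₂)
open import Data.Vec using ([]; _∷_; tabulate; lookup)
open import Data.Vec.Properties using ([]=⇒lookup; lookup⇒[]=; lookup∘tabulate; tabulate∘lookup; tabulate-cong)
open import Function using (_⇔_; mk⇔; Equivalence; Injective; _∘_)
open import Function.Construct.Identity using (⇔-id)
open import Function.Properties.Equivalence using (⇔-setoid)
open import Level using (0ℓ)
import Relation.Binary.Reasoning.Setoid as SetoidReasoning
open import Relation.Binary.PropositionalEquality
open import Relation.Nullary using (Dec; yes; no; does; contradiction)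
open import Relation.Unary using (Pred; Decidable)

module ⇔-Reasoning = SetoidReasoning (⇔-setoid 0ℓ)

open Sum +-0-commutativeMonoid using (sum; sum-permute; sum-cong-≗)

does≡true⇔ : ∀ {A : Set} (a? : Dec A) → does a? ≡ true ⇔ A
does≡true⇔ (yes a)  = mk⇔ (λ _ → a) (λ _ → refl)
does≡true⇔ (no ¬a) = mk⇔ (λ ()) (λ a → contradiction a ¬a)

∈⇔lookup≡true : ∀ {n} {p : Subset n} {x} → x ∈ p ⇔ lookup p x ≡ true
∈⇔lookup≡true {p = p} {x} = mk⇔ []=⇒lookup (lookup⇒[]= x p)

∈-tabulate⇔ : ∀ {n} (f : Fin n → Bool) {x} → x ∈ tabulate f ⇔ f x ≡ true
∈-tabulate⇔ f {x} = begin
  x ∈ tabulate f                ≈⟨ ∈⇔lookup≡true ⟩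
  lookup (tabulate f) x ≡ true  ≡⟨ cong (_≡ true) (lookup∘tabulate f x) ⟩
  f x ≡ true                    ∎
  where open ⇔-Reasoning

∈⇔∈⇒≡ : ∀ {n} {p q : Subset n} → (∀ x → x ∈ p ⇔ x ∈ q) → p ≡ q
∈⇔∈⇒≡ x∈p⇔x∈q = ⊆-antisym (Equivalence.to (x∈p⇔x∈q _)) (Equivalence.from (x∈p⇔x∈q _))

lookup-cong-⇔ : ∀ {m n} {p : Subset m} {q : Subset n} {x y} →
                x ∈ p ⇔ y ∈ q → lookup p x ≡ lookup q y
lookup-cong-⇔ {p = p} {q} {x} {y} x∈p⇔y∈q = ⇔→≡ (begin
  lookup p x ≡ true  ≈⟨ ∈⇔lookup≡true ⟨
  x ∈ p              ≈⟨ x∈p⇔y∈q ⟩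
  y ∈ q              ≈⟨ ∈⇔lookup≡true ⟩
  lookup q y ≡ true  ∎)
  where open ⇔-Reasoning

∣p∣≡sum : ∀ {n} (p : Subset n) → ∣ p ∣ ≡ sum (λ x → if lookup p x then 1 else 0)
∣p∣≡sum []          = refl
∣p∣≡sum (true ∷ p)  = cong suc (∣p∣≡sum p)
∣p∣≡sum (false ∷ p) = ∣p∣≡sum p

permutation⇒∣p∣≡∣q∣ : ∀ {m n} (π : Permutation m n) {p : Subset m} {q : Subset n} →
                      (∀ x → x ∈ p ⇔ π ⟨$⟩ʳ x ∈ q) → ∣ p ∣ ≡ ∣ q ∣
permutation⇒∣p∣≡∣q∣ π {p} {q} x∈p⇔πx∈q = begin
  ∣ p ∣                           ≡⟨ ∣p∣≡sum p ⟩
  sum (χ ∘ lookup p)              ≡⟨ sum-cong-≗ (cong χ ∘ lookup-cong-⇔ ∘ x∈p⇔πx∈q) ⟩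
  sum (χ ∘ lookup q ∘ (π ⟨$⟩ʳ_))  ≡⟨ sum-permute (χ ∘ lookup q) π ⟨
  sum (χ ∘ lookup q)              ≡⟨ ∣p∣≡sum q ⟨
  ∣ q ∣                           ∎
  where
  open ≡-Reasoning
  χ : Bool → ℕ
  χ b = if b then 1 else 0

x∈p∧∣p∣≤1⇒p≡⁅x⁆ : ∀ {n} {p : Subset n} {x} → x ∈ p → ∣ p ∣ ≤ 1 → p ≡ ⁅ x ⁆
x∈p∧∣p∣≤1⇒p≡⁅x⁆ {p = p} {x} x∈p ∣p∣≤1 = ⊆-antisym only-x ⁅x⁆⊆p
  where
  ⁅x⁆⊆p : ∀ {y} → y ∈ ⁅ x ⁆ → y ∈ p
  ⁅x⁆⊆p y∈⁅x⁆ = subst (_∈ p) (sym (x∈⁅y⁆⇒x≡y x y∈⁅x⁆)) x∈p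
  only-x : ∀ {y} → y ∈ p → y ∈ ⁅ x ⁆
  only-x {y} y∈p with y ≟ x
  ... | yes refl = x∈⁅x⁆ x
  ... | no  y≢x  = contradiction 1<∣p∣ (≤⇒≯ ∣p∣≤1)
    where
    ⁅x⁆⊂p : ⁅ x ⁆ ⊂ p
    ⁅x⁆⊂p = ⁅x⁆⊆p , y , y∈p , y≢x ∘ x∈⁅y⁆⇒x≡y x
    1<∣p∣ : 1 < ∣ p ∣
    1<∣p∣ = subst (_< ∣ p ∣) (∣⁅x⁆∣≡1 x) (p⊂q⇒∣p∣<∣q∣ ⁅x⁆⊂p)

lookup-injective : ∀ {A : Set} {xs : List A} → Unique xs → Injective _≡_ _≡_ (List.lookup xs)
lookup-injective {xs = _ ∷ _}  _         {zero}  {zero}  _  = refl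
lookup-injective {xs = _ ∷ xs} x∷xs!     {zero}  {suc j} eq =
  contradiction (subst (_∈ₗ xs) (sym eq) (∈-lookup j)) (Unique[x∷xs]⇒x∉xs x∷xs!)
lookup-injective {xs = _ ∷ xs} x∷xs!     {suc i} {zero}  eq =
  contradiction (subst (_∈ₗ xs) eq (∈-lookup i)) (Unique[x∷xs]⇒x∉xs x∷xs!)
lookup-injective {xs = _ ∷ _}  (_ ∷ xs!) {suc i} {suc j} eq = cong suc (lookup-injective xs! eq)

record Enumeration {m} (P : Pred (Fin m) 0ℓ) : Set where
  field
    size               : ℕ
    element            : Fin size → Fin m
    element-injective  : Injective _≡_ _≡_ element
    element-satisfies  : ∀ i → P (element i)
    element-surjective : ∀ x → P x → ∃[ i ] (element i ≡ x)

enumerate : ∀ {m} {P : Pred (Fin m) 0ℓ} → Decidable P → Enumeration P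
enumerate {m} P? = record
  { size               = length xs
  ; element            = List.lookup xs
  ; element-injective  = lookup-injective (filter⁺ P? (allFin⁺ m))
  ; element-satisfies  = λ i → proj₂ (∈-filter⁻ P? {xs = allFin m} (∈-lookup i))
  ; element-surjective = λ x Px → let x∈xs = ∈-filter⁺ P? (∈-allFin x) Px
                                  in index x∈xs , sym (lookup-index x∈xs)
  }
  where
  xs : List (Fin m)
  xs = filter P? (allFin m)

module FinGroupProperties (G : FinGroup) where
  open FinGroup G

  group : Group 0ℓ 0ℓ
  group = record
    { Carrier = Fin N ; _≈_ = _≡_ ; _∙_ = _·_ ; ε = e ; _⁻¹ = inv
    ; isGroup = record
      { isMonoid = record
        { isSemigroup = record
          { isMagma = record { isEquivalence = isEquivalence ; ∙-cong = cong₂ _·_ }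
          ; assoc   = assoc }
        ; identity = idˡ , idʳ }
      ; inverse  = invˡ , invʳ
      ; ⁻¹-cong  = cong inv } }

  open GroupProperties group public
    using (\\-leftDividesˡ; \\-leftDividesʳ; //-rightDividesˡ; ε⁻¹≈ε; ⁻¹-involutive; ⁻¹-anti-homo-∙; ∙-cancelʳ)

  leftMultiplication : Fin N → Permutation′ N
  leftMultiplication g = permutation (g ·_) (inv g ·_) (\\-leftDividesˡ g) (\\-leftDividesʳ g)

  ∈-translate : ∀ {g D x} → x ∈ translate G g D ⇔ inv g · x ∈ D
  ∈-translate {g} {D} {x} = begin
    x ∈ translate G g D          ≈⟨ ∈-tabulate⇔ _ ⟩
    lookup D (inv g · x) ≡ true  ≈⟨ ∈⇔lookup≡true ⟨
    inv g · x ∈ D                ∎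
    where open ⇔-Reasoning

  translate-∙ : ∀ g h D → translate G (g · h) D ≡ translate G g (translate G h D)
  translate-∙ g h D = tabulate-cong λ x → begin
    lookup D (inv (g · h) · x)            ≡⟨ cong (λ y → lookup D (y · x)) (⁻¹-anti-homo-∙ g h) ⟩
    lookup D ((inv h · inv g) · x)        ≡⟨ cong (lookup D) (assoc (inv h) (inv g) x) ⟩
    lookup D (inv h · (inv g · x))        ≡⟨ lookup∘tabulate _ (inv g · x) ⟨
    lookup (translate G h D) (inv g · x)  ∎
    where open ≡-Reasoning

  translate-e : ∀ D → translate G e D ≡ D
  translate-e D = begin
    tabulate (λ x → lookup D (inv e · x))  ≡⟨ tabulate-cong (λ x → cong (λ y → lookup D (y · x)) ε⁻¹≈ε) ⟩
    tabulate (λ x → lookup D (e · x))      ≡⟨ tabulate-cong (cong (lookup D) ∘ idˡ) ⟩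
    tabulate (lookup D)                    ≡⟨ tabulate∘lookup D ⟩
    D                                      ∎
    where open ≡-Reasoning

  ∣translate∣ : ∀ g D → ∣ translate G g D ∣ ≡ ∣ D ∣
  ∣translate∣ g D = permutation⇒∣p∣≡∣q∣ (leftMultiplication (inv g)) {q = D} (λ _ → ∈-translate)

  e∈translate-inv⇔ : ∀ {s D} → e ∈ translate G (inv s) D ⇔ s ∈ D
  e∈translate-inv⇔ {s} {D} = begin
    e ∈ translate G (inv s) D  ≈⟨ ∈-translate ⟩
    inv (inv s) · e ∈ D        ≡⟨ cong (_∈ D) (trans (idʳ _) (⁻¹-involutive s)) ⟩
    s ∈ D                      ∎
    where open ⇔-Reasoning

module _ (H : Hypergraph) where
  open Hypergraph H

  incidentEdges : Fin n → Subset m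
  incidentEdges v = tabulate (λ E → does (v ∈? edge E))

  ∈-incidentEdges : ∀ {v E} → E ∈ incidentEdges v ⇔ v ∈ edge E
  ∈-incidentEdges {v} {E} = begin
    E ∈ incidentEdges v        ≈⟨ ∈-tabulate⇔ _ ⟩
    does (v ∈? edge E) ≡ true  ≈⟨ does≡true⇔ (v ∈? edge E) ⟩
    v ∈ edge E                 ∎
    where open ⇔-Reasoning

  degree-preserved : (σ : Permutation′ n) (τ : Permutation′ m) →
                     (∀ v E → v ∈ edge E ⇔ σ ⟨$⟩ʳ v ∈ edge (τ ⟨$⟩ʳ E)) →
                     ∀ v → degree H v ≡ degree H (σ ⟨$⟩ʳ v)
  degree-preserved σ τ preserves v = permutation⇒∣p∣≡∣q∣ τ λ E → begin
    E ∈ incidentEdges v                    ≈⟨ ∈-incidentEdges ⟩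
    v ∈ edge E                             ≈⟨ preserves v E ⟩
    σ ⟨$⟩ʳ v ∈ edge (τ ⟨$⟩ʳ E)             ≈⟨ ∈-incidentEdges ⟨
    τ ⟨$⟩ʳ E ∈ incidentEdges (σ ⟨$⟩ʳ v)    ∎
    where open ⇔-Reasoning

module FromRegularAutGroup (H : Hypergraph) (linear : Linear H) (uniform : Uniform H) (R : RegularAutGroup H) where
  open Hypergraph H
  open RegularAutGroup R

  o : Fin n
  o = fromℕ< (>-nonZero⁻¹ n)

  rep : Fin n → Permutation′ n
  rep u = proj₁ (transitive o u)

  rep-A : ∀ u → A (rep u)
  rep-A u = proj₁ (proj₂ (transitive o u))

  rep-o : ∀ u → rep u ⟨$⟩ʳ o ≡ u
  rep-o u = proj₂ (proj₂ (transitive o u))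

  rep-unique : ∀ {σ} → A σ → σ ≈ₚ rep (σ ⟨$⟩ʳ o)
  rep-unique {σ} σ∈A = free σ (rep (σ ⟨$⟩ʳ o)) o σ∈A (rep-A _) (sym (rep-o _))

  flip-rep-o : ∀ u → flip (rep u) ⟨$⟩ʳ u ≡ o
  flip-rep-o u = trans (cong (flip (rep u) ⟨$⟩ʳ_) (sym (rep-o u))) (inverseˡ (rep u))

  vertexGroup : FinGroup
  vertexGroup = record
    { N     = n
    ; _·_   = λ x y → rep x ⟨$⟩ʳ y
    ; e     = o
    ; inv   = λ x → flip (rep x) ⟨$⟩ʳ o
    ; assoc = λ x y z → sym (trans (rep-unique (A-comp (rep y) (rep x) (rep-A y) (rep-A x)) z)
                                   (cong (λ t → rep (rep x ⟨$⟩ʳ t) ⟨$⟩ʳ z) (rep-o y)))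
    ; idˡ   = λ x → sym (rep-unique A-id x)
    ; idʳ   = rep-o
    ; invˡ  = λ x → trans (sym (rep-unique (A-inv (rep x) (rep-A x)) x)) (flip-rep-o x)
    ; invʳ  = λ x → inverseʳ (rep x)
    }

  open FinGroup vertexGroup using (_·_; inv; invʳ)
  open FinGroupProperties vertexGroup using (∈-translate; translate-∙; translate-e; e∈translate-inv⇔; \\-leftDividesˡ)

  translate-edge : ∀ g E → ∃[ E′ ] (translate vertexGroup g (edge E) ≡ edge E′)
  translate-edge g E with A-aut (rep g) (rep-A g) E
  ... | E′ , v∈E⇔gv∈E′ = E′ , ∈⇔∈⇒≡ λ x → begin
    x ∈ translate vertexGroup g (edge E)  ≈⟨ ∈-translate ⟩
    inv g · x ∈ edge E                    ≈⟨ v∈E⇔gv∈E′ _ ⟩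
    g · (inv g · x) ∈ edge E′             ≡⟨ cong (_∈ edge E′) (\\-leftDividesˡ g x) ⟩
    x ∈ edge E′                           ∎
    where open ⇔-Reasoning

  star : Enumeration (λ E → o ∈ edge E)
  star = enumerate (λ E → o ∈? edge E)

  open Enumeration star

  translate-through-o : ∀ g E → o ∈ translate vertexGroup g (edge E) →
                        ∃[ j ] (translate vertexGroup g (edge E) ≡ edge (element j))
  translate-through-o g E o∈gE with translate-edge g E
  ... | E′ , gE≡E′ with element-surjective E′ (subst (o ∈_) gE≡E′ o∈gE)
  ... | j , refl = j , gE≡E′

  starCollection : CayleyCollection vertexGroup
  starCollection = record
    { ℓ        = size
    ; k        = proj₁ uniform
    ; C        = edge ∘ element
    ; distinct = element-injective ∘ edge-inj
    ; size     = proj₂ uniform ∘ element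
    ; has-e    = element-satisfies
    ; meet     = λ i j i≢j → x∈p∧∣p∣≤1⇒p≡⁅x⁆ (x∈p∩q⁺ (element-satisfies i , element-satisfies j))
                                              (linear _ _ (i≢j ∘ element-injective))
    ; T-axiom  = λ i s s∈Ci → translate-through-o (inv s) (element i) (Equivalence.from e∈translate-inv⇔ s∈Ci)
    }

  edge∈β : ∀ E → InBeta vertexGroup starCollection (edge E)
  edge∈β E with edge-ne E
  ... | w , w∈E with translate-through-o (inv w) E (Equivalence.from e∈translate-inv⇔ w∈E)
  ... | j , w⁻¹E≡Cj = w , j , (begin
    edge E                                     ≡⟨ translate-e (edge E) ⟨
    translate′ o (edge E)                      ≡⟨ cong (λ g → translate′ g (edge E)) (invʳ w) ⟨
    translate′ (w · inv w) (edge E)            ≡⟨ translate-∙ w (inv w) (edge E) ⟩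
    translate′ w (translate′ (inv w) (edge E)) ≡⟨ cong (translate′ w) w⁻¹E≡Cj ⟩
    translate′ w (edge (element j))            ∎)
    where
    open ≡-Reasoning
    translate′ : Fin n → Subset n → Subset n
    translate′ = translate vertexGroup

  β⊆edges : ∀ D → InBeta vertexGroup starCollection D → ∃[ E ] (edge E ≡ D)
  β⊆edges D (g , i , refl) with translate-edge g (element i)
  ... | E′ , gCi≡E′ = E′ , sym gCi≡E′

  cayleyIncidence : BCayIso vertexGroup H starCollection
  cayleyIncidence = record
    { φ         = id
    ; ψ         = edge
    ; ψ-inj     = edge-inj
    ; ψ-into    = edge∈β
    ; ψ-onto    = β⊆edges
    ; incidence = λ _ _ → ⇔-id _
    }

module FromCayleyIncidence (H : Hypergraph) (G : FinGroup) (π : CayleyCollection G) (iso : BCayIso G H π) where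
  open Hypergraph H
  open FinGroup G
  open CayleyCollection π
  open BCayIso iso
  open FinGroupProperties G

  ⟦_⟧ : Fin n → Fin N
  ⟦ v ⟧ = φ ⟨$⟩ʳ v

  vertexShift : Fin N → Permutation′ n
  vertexShift y = φ ∘ₚ leftMultiplication y ∘ₚ flip φ

  ⟦vertexShift⟧ : ∀ y v → ⟦ vertexShift y ⟨$⟩ʳ v ⟧ ≡ y · ⟦ v ⟧
  ⟦vertexShift⟧ y v = inverseʳ φ

  vertexShift-e : vertexShift e ≈ₚ id
  vertexShift-e v = trans (cong (φ ⟨$⟩ˡ_) (idˡ ⟦ v ⟧)) (inverseˡ φ)

  vertexShift-∙ : ∀ y z → vertexShift (y · z) ≈ₚ vertexShift z ∘ₚ vertexShift y
  vertexShift-∙ y z v = cong (φ ⟨$⟩ˡ_) (begin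
    (y · z) · ⟦ v ⟧                    ≡⟨ assoc y z ⟦ v ⟧ ⟩
    y · (z · ⟦ v ⟧)                    ≡⟨ cong (y ·_) (⟦vertexShift⟧ z v) ⟨
    y · ⟦ vertexShift z ⟨$⟩ʳ v ⟧       ∎)
    where open ≡-Reasoning

  vertexShift-injective : ∀ {y z} u → vertexShift y ⟨$⟩ʳ u ≡ vertexShift z ⟨$⟩ʳ u → y ≡ z
  vertexShift-injective {y} {z} u eq = ∙-cancelʳ ⟦ u ⟧ y z (begin
    y · ⟦ u ⟧                     ≡⟨ ⟦vertexShift⟧ y u ⟨
    ⟦ vertexShift y ⟨$⟩ʳ u ⟧      ≡⟨ cong ⟦_⟧ eq ⟩
    ⟦ vertexShift z ⟨$⟩ʳ u ⟧      ≡⟨ ⟦vertexShift⟧ z u ⟩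
    z · ⟦ u ⟧                     ∎)
    where open ≡-Reasoning

  vertexShift-transitive : ∀ u v → vertexShift (⟦ v ⟧ · inv ⟦ u ⟧) ⟨$⟩ʳ u ≡ v
  vertexShift-transitive u v = trans (cong (φ ⟨$⟩ˡ_) (//-rightDividesˡ ⟦ u ⟧ ⟦ v ⟧)) (inverseˡ φ)

  InBeta-translate : ∀ y {D} → InBeta G π D → InBeta G π (translate G y D)
  InBeta-translate y (g , i , refl) = y · g , i , sym (translate-∙ y g (C i))

  edgeShift : Fin N → Fin m → Fin m
  edgeShift y E = proj₁ (ψ-onto _ (InBeta-translate y (ψ-into E)))

  ψ-edgeShift : ∀ y E → ψ (edgeShift y E) ≡ translate G y (ψ E)
  ψ-edgeShift y E = proj₂ (ψ-onto _ (InBeta-translate y (ψ-into E)))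

  edgeShift-inverse : ∀ y z → y · z ≡ e → ∀ E → edgeShift y (edgeShift z E) ≡ E
  edgeShift-inverse y z yz≡e E = ψ-inj (begin
    ψ (edgeShift y (edgeShift z E))      ≡⟨ ψ-edgeShift y _ ⟩
    translate G y (ψ (edgeShift z E))    ≡⟨ cong (translate G y) (ψ-edgeShift z E) ⟩
    translate G y (translate G z (ψ E))  ≡⟨ translate-∙ y z (ψ E) ⟨
    translate G (y · z) (ψ E)            ≡⟨ cong (λ g → translate G g (ψ E)) yz≡e ⟩
    translate G e (ψ E)                  ≡⟨ translate-e (ψ E) ⟩
    ψ E                                  ∎)
    where open ≡-Reasoning

  edgeShiftPermutation : Fin N → Permutation′ m
  edgeShiftPermutation y = permutation (edgeShift y) (edgeShift (inv y))
    (edgeShift-inverse y (inv y) (invʳ y)) (edgeShift-inverse (inv y) y (invˡ y))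

  shift-incidence : ∀ y v E → v ∈ edge E ⇔ vertexShift y ⟨$⟩ʳ v ∈ edge (edgeShift y E)
  shift-incidence y v E = begin
    v ∈ edge E                                     ≈⟨ incidence v E ⟩
    ⟦ v ⟧ ∈ ψ E                                    ≡⟨ cong (_∈ ψ E) (\\-leftDividesʳ y ⟦ v ⟧) ⟨
    inv y · (y · ⟦ v ⟧) ∈ ψ E                      ≈⟨ ∈-translate ⟨
    y · ⟦ v ⟧ ∈ translate G y (ψ E)                ≡⟨ cong₂ _∈_ (⟦vertexShift⟧ y v) (ψ-edgeShift y E) ⟨
    ⟦ vertexShift y ⟨$⟩ʳ v ⟧ ∈ ψ (edgeShift y E)   ≈⟨ incidence _ _ ⟨
    vertexShift y ⟨$⟩ʳ v ∈ edge (edgeShift y E)    ∎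
    where open ⇔-Reasoning

  uniform : Uniform H
  uniform = k , λ E → ∣edge∣≡k E (ψ-into E)
    where
    ∣edge∣≡k : ∀ E → InBeta G π (ψ E) → ∣ edge E ∣ ≡ k
    ∣edge∣≡k E (g , i , ψE≡gCi) = begin
      ∣ edge E ∣               ≡⟨ permutation⇒∣p∣≡∣q∣ φ (λ v → incidence v E) ⟩
      ∣ ψ E ∣                  ≡⟨ cong ∣_∣ ψE≡gCi ⟩
      ∣ translate G g (C i) ∣  ≡⟨ ∣translate∣ g (C i) ⟩
      ∣ C i ∣                  ≡⟨ size i ⟩
      k                        ∎
      where open ≡-Reasoning

  degree-vertexShift : ∀ y v → degree H (vertexShift y ⟨$⟩ʳ v) ≡ degree H v
  degree-vertexShift y v =
    sym (degree-preserved H (vertexShift y) (edgeShiftPermutation y) (shift-incidence y) v)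

  regular : Regular H
  regular = degree H o , λ v →
    trans (cong (degree H) (sym (vertexShift-transitive o v))) (degree-vertexShift _ o)
    where
    o : Fin n
    o = φ ⟨$⟩ˡ e

  IsVertexShift : Permutation′ n → Set
  IsVertexShift σ = ∃[ y ] (σ ≈ₚ vertexShift y)

  flip-vertexShift : ∀ {σ y} → σ ≈ₚ vertexShift y → flip σ ≈ₚ vertexShift (inv y)
  flip-vertexShift {σ} {y} σ≈ v = begin
    flip σ ⟨$⟩ʳ v                 ≡⟨ cong (flip σ ⟨$⟩ʳ_) σw≡v ⟨
    flip σ ⟨$⟩ʳ (σ ⟨$⟩ʳ w)        ≡⟨ inverseˡ σ ⟩
    w                             ∎
    where
    open ≡-Reasoning
    w : Fin n
    w = vertexShift (inv y) ⟨$⟩ʳ v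
    σw≡v : σ ⟨$⟩ʳ w ≡ v
    σw≡v = begin
      σ ⟨$⟩ʳ w                       ≡⟨ σ≈ w ⟩
      vertexShift y ⟨$⟩ʳ w           ≡⟨ vertexShift-∙ y (inv y) v ⟨
      vertexShift (y · inv y) ⟨$⟩ʳ v  ≡⟨ cong (λ z → vertexShift z ⟨$⟩ʳ v) (invʳ y) ⟩
      vertexShift e ⟨$⟩ʳ v            ≡⟨ vertexShift-e v ⟩
      v                              ∎

  vertexShiftGroup : RegularAutGroup H
  vertexShiftGroup = record
    { A          = IsVertexShift
    ; A-aut      = λ { σ (y , σ≈) E → edgeShift y E , λ v →
                     subst (λ w → v ∈ edge E ⇔ w ∈ edge (edgeShift y E)) (sym (σ≈ v)) (shift-incidence y v E) }
    ; A-id       = e , sym ∘ vertexShift-e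
    ; A-comp     = λ { σ τ (y , σ≈) (z , τ≈) → z · y , λ v →
                     trans (τ≈ _) (trans (cong (vertexShift z ⟨$⟩ʳ_) (σ≈ v)) (sym (vertexShift-∙ z y v))) }
    ; A-inv      = λ { σ (y , σ≈) → inv y , flip-vertexShift {σ} σ≈ }
    ; transitive = λ u v → vertexShift _ , (_ , λ _ → refl) , vertexShift-transitive u v
    ; free       = λ { σ τ u (y , σ≈) (z , τ≈) σu≡τu w →
                     let y≡z = vertexShift-injective u (trans (sym (σ≈ u)) (trans σu≡τu (τ≈ u)))
                     in trans (σ≈ w) (trans (cong (λ x → vertexShift x ⟨$⟩ʳ w) y≡z) (sym (τ≈ w))) }
    }

corollary4p5 : (H : Hypergraph) → Linear H →
    ((Uniform H × Regular H × AdmitsRegularAutGroup H) ⇔ IsBCayIncidence H)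
corollary4p5 H linear = mk⇔
  (λ { (uniform , _ , R) → let open FromRegularAutGroup H linear uniform R
                           in vertexGroup , starCollection , cayleyIncidence })
  (λ { (G , π , iso) → let open FromCayleyIncidence H G π iso
                       in uniform , regular , vertexShiftGroup })
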